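{- For every $n$ there exists an edge-colored directed graph $G$ with $\Theta(n)$ vertices such that every $1$-color-fault-tolerant connectivity preserver $H\subseteq G$ of $G$ has $\tilde{\Omega}(n^2)$ edges (specifically $\Omega(n^2/\log n)$).
   Context: An edge-colored directed graph $G$ comes with a partition $\mathcal{C}$ of $E(G)$ into color classes. A subgraph $H$ of $G$ ($V(H)=V(G)$, $E(H)\subseteq E(G)$) is a $k$-color-fault-tolerant connectivity preserver if for every pair of vertices $u,v$ and every family $\mathcal{F}\subseteq\mathcal{C}$ of at most $k$ colors, $u,v$ are strongly connected in $G-\bigcup\mathcal{F}$ if and only if they are strongly connected in $H-\bigcup\mathcal{F}$, where $\bigcup\mathcal{F}$ is the union of the edge sets of the colors in $\mathcal{F}$. $\tilde\Omega$ hides polylogarithmic factors. -}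

module Defs where

open import Data.Nat using (ℕ; _*_; _^_; _≤_)
open import Data.Fin using (Fin)
open import Data.Fin.Subset using (Subset; _∈_; ∣_∣)
open import Data.Maybe using (Maybe; just; nothing)
open import Data.Empty using (⊥)
open import Data.Product using (_×_; Σ; ∃-syntax)
open import Relation.Nullary using (¬_)
open import Relation.Binary.PropositionalEquality using (_≡_; _≢_)

-- An edge-colored directed graph: vertices Fin nV, edges Fin nE,
-- each edge e is the arc src e → tgt e and carries a color col e.
-- The color classes {e | col e ≡ c} form the partition 𝒞 of E(G).
record ColoredDigraph : Set where
  field
    nV  : ℕ
    nE  : ℕ
    src : Fin nE → Fin nV
    tgt : Fin nE → Fin nV
    col : Fin nE → ℕ
open ColoredDigraph public

Simple : ColoredDigraph → Set
Simple G = (∀ e → src G e ≢ tgt G e)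
         × (∀ e e′ → src G e ≡ src G e′ → tgt G e ≡ tgt G e′ → e ≡ e′)

data Reach (G : ColoredDigraph) (allowed : Fin (nE G) → Set)
     : Fin (nV G) → Fin (nV G) → Set where
  here : ∀ {u} → Reach G allowed u u
  step : ∀ {u v} (e : Fin (nE G)) → allowed e → src G e ≡ u
       → Reach G allowed (tgt G e) v → Reach G allowed u v

StronglyConnected : (G : ColoredDigraph) → (Fin (nE G) → Set)
                  → Fin (nV G) → Fin (nV G) → Set
StronglyConnected G allowed u v = Reach G allowed u v × Reach G allowed v u

-- A family of at most one color: nothing = ∅, just c = {c}.
Removed : Maybe ℕ → ℕ → Set
Removed nothing  c = ⊥
Removed (just f) c = c ≡ f

AllowedG : (G : ColoredDigraph) → Maybe ℕ → Fin (nE G) → Set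
AllowedG G F e = ¬ Removed F (col G e)

AllowedH : (G : ColoredDigraph) → Subset (nE G) → Maybe ℕ → Fin (nE G) → Set
AllowedH G H F e = (e ∈ H) × (¬ Removed F (col G e))

OneCFTPreserver : (G : ColoredDigraph) → Subset (nE G) → Set
OneCFTPreserver G H =
  ∀ (F : Maybe ℕ) (u v : Fin (nV G)) →
    (StronglyConnected G (AllowedG G F) u v → StronglyConnected G (AllowedH G H F) u v)
  × (StronglyConnected G (AllowedH G H F) u v → StronglyConnected G (AllowedG G F) u v)

{-# OPTIONS --safe #-}
module Submission where

-- The graph is a binary tree with 2^k leaves together with n hubs; every leaf has an uncoloured
-- edge to every hub and every hub an uncoloured edge back to the root.  Leaf c owns colour c, and
-- the tree is wired so that once colour c fails, the only leaf still reachable from the root is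
-- leaf c: the path from a node into its left subtree is a chain containing one edge of every
-- colour owned by the right subtree, and symmetrically.  Hence under the fault c, leaf c and hub j
-- are strongly connected, but a path from leaf c to hub j that avoids c can only enter hub j from
-- leaf c itself.  So every preserver keeps all 2^k n leaf-hub edges, and for 2^k ≈ n / log n the
-- tree has O(k 2^k) = O(n) vertices.

open import Defs
open import Data.Nat using (ℕ; zero; suc; _+_; _*_; _^_; _∸_; _≤_; _<_; z≤n; s≤s; ⌊_/2⌋; ⌈_/2⌉)
open import Data.Nat.Induction using (<-wellFounded)
open import Induction.WellFounded using (Acc; acc)
open import Data.Nat.Properties
  using ( suc-injective; +-identityʳ; *-identityˡ; *-identityʳ; *-distribˡ-+; ^-distribˡ-+-*; m^n>0
        ; ≤-refl; ≤-reflexive; ≤-trans; <⇒≤; ≰⇒>; n≮n; m≤m+n; m∸n≤m; m∸n+n≡m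
        ; +-monoʳ-≤; +-mono-≤; *-monoʳ-≤; *-monoˡ-≤; ⌊n/2⌋≤⌈n/2⌉; ⌊n/2⌋+⌈n/2⌉≡n; module ≤-Reasoning )
open import Data.Nat.Tactic.RingSolver using (solve-∀)
open import Data.Nat.Logarithm using (⌊log₂_⌋; ⌊log₂⌋-mono-≤; ⌊log₂[2^n]⌋≡n)
open import Data.Nat.Logarithm.Core using (⌊log2⌋)
open import Data.Fin as Fin using (Fin; toℕ; _↑ˡ_)
open import Data.Fin.Properties using (+↔⊎; *↔×; 1↔⊤; 0↔⊥; toℕ-injective)
open import Data.Fin.Subset using (Subset; _∈_; ∣_∣)
open import Data.Fin.Subset.Properties using (drop-there)
open import Data.Vec using (_∷_; here)
open import Data.Unit using (⊤; tt)
open import Data.Empty using (⊥; ⊥-elim)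
open import Data.Sum using (_⊎_; inj₁; inj₂)
open import Data.Sum.Properties using (inj₁-injective; inj₂-injective)
open import Data.Sum.Function.Propositional using (_⊎-↔_)
open import Data.Product using (_×_; _,_; proj₁; ∃-syntax)
open import Data.Product.Function.NonDependent.Propositional using (_×-↔_)
open import Data.Maybe as Maybe using (Maybe; just; nothing; maybe)
open import Data.Maybe.Properties using (just-injective; map-injective)
open import Function using (_∘_)
open import Function.Bundles using (_↔_; Inverse; Injection)
open import Function.Properties.Inverse using (↔-refl; ↔-sym; ↔-trans; ↔⇒↣)
open import Relation.Nullary using (¬_)
open import Relation.Binary.PropositionalEquality
  using (_≡_; _≢_; refl; sym; trans; cong; cong₂; subst; subst₂)

record Graph : Set₁ where
  field
    Vertex : Set
    Edge   : Set
    source : Edge → Vertex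
    target : Edge → Vertex

open Graph

data Walk (Γ : Graph) (allowed : Edge Γ → Set) : Vertex Γ → Vertex Γ → Set where
  []   : ∀ {x} → Walk Γ allowed x x
  step : ∀ {y} (e : Edge Γ) → allowed e → Walk Γ allowed (target Γ e) y
       → Walk Γ allowed (source Γ e) y

module _ {Γ : Graph} {allowed : Edge Γ → Set} where

  _++_ : ∀ {x y z} → Walk Γ allowed x y → Walk Γ allowed y z → Walk Γ allowed x z
  []           ++ w′ = w′
  (step e a w) ++ w′ = step e a (w ++ w′)

  preserved-along : (P : Vertex Γ → Set)
                  → (∀ e → allowed e → P (source Γ e) → P (target Γ e))
                  → ∀ {x y} → Walk Γ allowed x y → P x → P y
  preserved-along P closed []           p = p
  preserved-along P closed (step e a w) p = preserved-along P closed w (closed e a p)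

record Hom (Γ Δ : Graph) : Set where
  constructor hom
  field
    vertex          : Vertex Γ → Vertex Δ
    edge            : Edge Γ → Edge Δ
    source-commutes : ∀ e → source Δ (edge e) ≡ vertex (source Γ e)
    target-commutes : ∀ e → target Δ (edge e) ≡ vertex (target Γ e)

open Hom

walk-map : ∀ {Γ Δ A B} (h : Hom Γ Δ) → (∀ e → A e → B (edge h e))
         → ∀ {x y} → Walk Γ A x y → Walk Δ B (vertex h x) (vertex h y)
walk-map h f []           = []
walk-map {Δ = Δ} {B = B} h f (step {y} e a w) =
  subst (λ v → Walk Δ B v (vertex h y)) (source-commutes h e)
    (step (edge h e) (f e a)
      (subst (λ v → Walk Δ B v (vertex h y)) (sym (target-commutes h e)) (walk-map h f w)))

module _ (Γ : Graph) (inEdge : Vertex Γ → Maybe (Edge Γ))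
         (inEdge-target : ∀ e → inEdge (target Γ e) ≡ just e) where

  inEdge⇒target-injective : ∀ {e e′} → target Γ e ≡ target Γ e′ → e ≡ e′
  inEdge⇒target-injective {e} {e′} eq =
    just-injective (trans (sym (inEdge-target e)) (trans (cong inEdge eq) (inEdge-target e′)))

  inEdge-nothing⇒target≢ : ∀ {x} → inEdge x ≡ nothing → ∀ e → target Γ e ≢ x
  inEdge-nothing⇒target≢ none e refl with trans (sym (inEdge-target e)) none
  ... | ()

-- Encoding as a coloured digraph on Fin

module Encoding (Γ : Graph) {m n : ℕ} (vertices : Vertex Γ ↔ Fin m) (edges : Edge Γ ↔ Fin n)
                (colour : Edge Γ → ℕ) where

  private
    module V = Inverse vertices
    module E = Inverse edges

  encodeVertex : Vertex Γ → Fin m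
  encodeVertex = V.to

  encodeEdge : Edge Γ → Fin n
  encodeEdge = E.to

  digraph : ColoredDigraph
  digraph = record
    { nV  = m
    ; nE  = n
    ; src = V.to ∘ source Γ ∘ E.from
    ; tgt = V.to ∘ target Γ ∘ E.from
    ; col = colour ∘ E.from
    }

  col-encodeEdge : ∀ e → col digraph (E.to e) ≡ colour e
  col-encodeEdge e = cong colour (E.strictlyInverseʳ e)

  walk→reach : ∀ {A : Fin n → Set} {x y} → Walk Γ (A ∘ E.to) x y → Reach digraph A (V.to x) (V.to y)
  walk→reach []                     = here
  walk→reach {A} (step {y} e a w) =
    step (E.to e) a (cong (V.to ∘ source Γ) (E.strictlyInverseʳ e))
      (subst (λ v → Reach digraph A v (V.to y)) (cong (V.to ∘ target Γ) (sym (E.strictlyInverseʳ e)))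
        (walk→reach w))

  reach→walk : ∀ {A : Fin n → Set} {u v} → Reach digraph A u v → Walk Γ (A ∘ E.to) (V.from u) (V.from v)
  reach→walk here                     = []
  reach→walk {A} {v = v} (step e a refl r) =
    subst (λ x → Walk Γ (A ∘ E.to) x (V.from v)) (sym (V.strictlyInverseʳ (source Γ (E.from e))))
      (step (E.from e) (subst A (sym (E.strictlyInverseˡ e)) a)
        (subst (λ x → Walk Γ (A ∘ E.to) x (V.from v)) (V.strictlyInverseʳ (target Γ (E.from e)))
          (reach→walk r)))

  reach→walk-encoded : ∀ {A : Fin n → Set} {x y} → Reach digraph A (V.to x) (V.to y) → Walk Γ (A ∘ E.to) x y
  reach→walk-encoded r = subst₂ (Walk Γ _) (V.strictlyInverseʳ _) (V.strictlyInverseʳ _) (reach→walk r)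

  digraph-simple : (∀ e → source Γ e ≢ target Γ e)
                 → (∀ e e′ → source Γ e ≡ source Γ e′ → target Γ e ≡ target Γ e′ → e ≡ e′)
                 → Simple digraph
  digraph-simple loopless no-parallel =
      (λ e → loopless (E.from e) ∘ V-injective)
    , (λ e e′ s t → E-from-injective (no-parallel (E.from e) (E.from e′) (V-injective s) (V-injective t)))
    where
      V-injective : ∀ {x y} → V.to x ≡ V.to y → x ≡ y
      V-injective = Injection.injective (↔⇒↣ vertices)
      E-from-injective : ∀ {e e′} → E.from e ≡ E.from e′ → e ≡ e′
      E-from-injective = Injection.injective (↔⇒↣ (↔-sym edges))

_⊎ᶠ_ : ∀ {A B : Set} {m n} → A ↔ Fin m → B ↔ Fin n → (A ⊎ B) ↔ Fin (m + n)
eA ⊎ᶠ eB = ↔-trans (eA ⊎-↔ eB) (↔-sym +↔⊎)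

_×ᶠ_ : ∀ {A B : Set} {m n} → A ↔ Fin m → B ↔ Fin n → (A × B) ↔ Fin (m * n)
eA ×ᶠ eB = ↔-trans (eA ×-↔ eB) (↔-sym *↔×)

⊤ᶠ : ⊤ ↔ Fin 1
⊤ᶠ = ↔-sym 1↔⊤

⊥ᶠ : ⊥ ↔ Fin 0
⊥ᶠ = ↔-sym 0↔⊥

prefix⊆p⇒m≤∣p∣ : ∀ m {n} (p : Subset (m + n)) → (∀ i → i ↑ˡ n ∈ p) → m ≤ ∣ p ∣
prefix⊆p⇒m≤∣p∣ zero    p       prefix⊆p = z≤n
prefix⊆p⇒m≤∣p∣ (suc m) (b ∷ p) prefix⊆p with prefix⊆p Fin.zero
... | here = s≤s (prefix⊆p⇒m≤∣p∣ m p (drop-there ∘ prefix⊆p ∘ Fin.suc))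

map-inj₁≢just-inj₂ : ∀ {A B : Set} (m : Maybe A) {b : B} → Maybe.map inj₁ m ≢ just (inj₂ b)
map-inj₁≢just-inj₂ nothing  ()
map-inj₁≢just-inj₂ (just _) ()

map-inj₂≢just-inj₁ : ∀ {A B : Set} (m : Maybe B) {a : A} → Maybe.map inj₂ m ≢ just (inj₁ a)
map-inj₂≢just-inj₁ nothing  ()
map-inj₂≢just-inj₁ (just _) ()

-- Chains and the tree gadget

Leaf : ℕ → Set
Leaf zero    = ⊤
Leaf (suc k) = Leaf k ⊎ Leaf k

ChainVertex : ℕ → Set
ChainVertex zero    = ⊤ ⊎ ⊤
ChainVertex (suc k) = ChainVertex k ⊎ ChainVertex k

ChainEdge : ℕ → Set
ChainEdge zero    = ⊤
ChainEdge (suc k) = ChainEdge k ⊎ (⊤ ⊎ ChainEdge k)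

pattern bridge = inj₂ (inj₁ tt)

first : ∀ k → ChainVertex k
first zero    = inj₁ tt
first (suc k) = inj₁ (first k)

last : ∀ k → ChainVertex k
last zero    = inj₂ tt
last (suc k) = inj₂ (last k)

chainSource : ∀ k → ChainEdge k → ChainVertex k
chainSource zero    _                = first zero
chainSource (suc k) (inj₁ e)         = inj₁ (chainSource k e)
chainSource (suc k) bridge           = inj₁ (last k)
chainSource (suc k) (inj₂ (inj₂ e))  = inj₂ (chainSource k e)

chainTarget : ∀ k → ChainEdge k → ChainVertex k
chainTarget zero    _                = last zero
chainTarget (suc k) (inj₁ e)         = inj₁ (chainTarget k e)
chainTarget (suc k) bridge           = inj₂ (first k)
chainTarget (suc k) (inj₂ (inj₂ e))  = inj₂ (chainTarget k e)

chain : ℕ → Graph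
chain k = record { Vertex = ChainVertex k ; Edge = ChainEdge k ; source = chainSource k ; target = chainTarget k }

chainColour : ∀ k → ChainEdge k → Maybe (Leaf k)
chainColour zero    _               = just tt
chainColour (suc k) (inj₁ e)        = Maybe.map inj₁ (chainColour k e)
chainColour (suc k) bridge          = nothing
chainColour (suc k) (inj₂ (inj₂ e)) = Maybe.map inj₂ (chainColour k e)

-- x lies strictly before the edge coloured c, i.e. x is reachable from first k once c fails.
Before : ∀ {k} → Leaf k → ChainVertex k → Set
Before {zero}  _        (inj₁ _) = ⊤
Before {zero}  _        (inj₂ _) = ⊥
Before {suc k} (inj₁ c) (inj₁ x) = Before c x
Before {suc k} (inj₁ c) (inj₂ x) = ⊥
Before {suc k} (inj₂ c) (inj₁ x) = ⊤
Before {suc k} (inj₂ c) (inj₂ x) = Before c x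

before-first : ∀ k (c : Leaf k) → Before c (first k)
before-first zero    _        = tt
before-first (suc k) (inj₁ c) = before-first k c
before-first (suc k) (inj₂ c) = tt

¬before-last : ∀ k (c : Leaf k) → ¬ Before c (last k)
¬before-last zero    _        ()
¬before-last (suc k) (inj₁ c) ()
¬before-last (suc k) (inj₂ c) = ¬before-last k c

before-closed : ∀ k (c : Leaf k) e → chainColour k e ≢ just c
              → Before c (chainSource k e) → Before c (chainTarget k e)
before-closed zero    tt       tt              ≢c _ = ⊥-elim (≢c refl)
before-closed (suc k) (inj₁ c) (inj₁ e)        ≢c   = before-closed k c e (≢c ∘ cong (Maybe.map inj₁))
before-closed (suc k) (inj₁ c) bridge          _    = ¬before-last k c
before-closed (suc k) (inj₁ c) (inj₂ (inj₂ e)) _    ()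
before-closed (suc k) (inj₂ c) (inj₁ e)        _  _ = tt
before-closed (suc k) (inj₂ c) bridge          _  _ = before-first k c
before-closed (suc k) (inj₂ c) (inj₂ (inj₂ e)) ≢c   = before-closed k c e (≢c ∘ cong (Maybe.map inj₂))

chain-traversal : ∀ k → Walk (chain k) (λ _ → ⊤) (first k) (last k)
chain-traversal zero    = step tt tt []
chain-traversal (suc k) =
  walk-map front (λ _ _ → tt) (chain-traversal k)
  ++ step bridge tt (walk-map back (λ _ _ → tt) (chain-traversal k))
  where
    front back : Hom (chain k) (chain (suc k))
    front = hom inj₁ inj₁ (λ _ → refl) (λ _ → refl)
    back  = hom inj₂ (inj₂ ∘ inj₂) (λ _ → refl) (λ _ → refl)

chain-loopless : ∀ k e → chainSource k e ≢ chainTarget k e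
chain-loopless zero    _               ()
chain-loopless (suc k) (inj₁ e)        = chain-loopless k e ∘ inj₁-injective
chain-loopless (suc k) bridge          ()
chain-loopless (suc k) (inj₂ (inj₂ e)) = chain-loopless k e ∘ inj₂-injective

chainInEdge : ∀ k → ChainVertex k → Maybe (ChainEdge k)
chainInEdge zero    (inj₁ _) = nothing
chainInEdge zero    (inj₂ _) = just tt
chainInEdge (suc k) (inj₁ x) = Maybe.map inj₁ (chainInEdge k x)
chainInEdge (suc k) (inj₂ x) = maybe (λ e → just (inj₂ (inj₂ e))) (just bridge) (chainInEdge k x)

chainInEdge-first : ∀ k → chainInEdge k (first k) ≡ nothing
chainInEdge-first zero    = refl
chainInEdge-first (suc k) rewrite chainInEdge-first k = refl

chainInEdge-target : ∀ k e → chainInEdge k (chainTarget k e) ≡ just e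
chainInEdge-target zero    tt              = refl
chainInEdge-target (suc k) (inj₁ e)        rewrite chainInEdge-target k e = refl
chainInEdge-target (suc k) bridge          rewrite chainInEdge-first k    = refl
chainInEdge-target (suc k) (inj₂ (inj₂ e)) rewrite chainInEdge-target k e = refl

BelowRoot : ℕ → Set
BelowRoot zero    = ⊥
BelowRoot (suc k) = (ChainVertex k ⊎ (⊤ ⊎ BelowRoot k)) ⊎ (ChainVertex k ⊎ (⊤ ⊎ BelowRoot k))

TreeVertex : ℕ → Set
TreeVertex k = ⊤ ⊎ BelowRoot k

-- chainL is the chain from the root into the left subtree; it carries the right leaves' colours.
pattern root     = inj₁ tt
pattern chainL x = inj₂ (inj₁ (inj₁ x))
pattern subL x   = inj₂ (inj₁ (inj₂ x))
pattern chainR x = inj₂ (inj₂ (inj₁ x))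
pattern subR x   = inj₂ (inj₂ (inj₂ x))

TreeEdge : ℕ → Set
TreeEdge zero    = ⊥
TreeEdge (suc k) = (⊤ ⊎ (ChainEdge k ⊎ (⊤ ⊎ TreeEdge k))) ⊎ (⊤ ⊎ (ChainEdge k ⊎ (⊤ ⊎ TreeEdge k)))

pattern enterL    = inj₁ (inj₁ tt)
pattern alongL e  = inj₁ (inj₂ (inj₁ e))
pattern exitL     = inj₁ (inj₂ (inj₂ (inj₁ tt)))
pattern withinL e = inj₁ (inj₂ (inj₂ (inj₂ e)))
pattern enterR    = inj₂ (inj₁ tt)
pattern alongR e  = inj₂ (inj₂ (inj₁ e))
pattern exitR     = inj₂ (inj₂ (inj₂ (inj₁ tt)))
pattern withinR e = inj₂ (inj₂ (inj₂ (inj₂ e)))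

treeSource : ∀ k → TreeEdge k → TreeVertex k
treeSource (suc k) enterL      = root
treeSource (suc k) (alongL e)  = chainL (chainSource k e)
treeSource (suc k) exitL       = chainL (last k)
treeSource (suc k) (withinL e) = subL (treeSource k e)
treeSource (suc k) enterR      = root
treeSource (suc k) (alongR e)  = chainR (chainSource k e)
treeSource (suc k) exitR       = chainR (last k)
treeSource (suc k) (withinR e) = subR (treeSource k e)

treeTarget : ∀ k → TreeEdge k → TreeVertex k
treeTarget (suc k) enterL      = chainL (first k)
treeTarget (suc k) (alongL e)  = chainL (chainTarget k e)
treeTarget (suc k) exitL       = subL root
treeTarget (suc k) (withinL e) = subL (treeTarget k e)
treeTarget (suc k) enterR      = chainR (first k)
treeTarget (suc k) (alongR e)  = chainR (chainTarget k e)
treeTarget (suc k) exitR       = subR root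
treeTarget (suc k) (withinR e) = subR (treeTarget k e)

tree : ℕ → Graph
tree k = record { Vertex = TreeVertex k ; Edge = TreeEdge k ; source = treeSource k ; target = treeTarget k }

treeColour : ∀ k → TreeEdge k → Maybe (Leaf k)
treeColour (suc k) enterL      = nothing
treeColour (suc k) (alongL e)  = Maybe.map inj₂ (chainColour k e)
treeColour (suc k) exitL       = nothing
treeColour (suc k) (withinL e) = Maybe.map inj₁ (treeColour k e)
treeColour (suc k) enterR      = nothing
treeColour (suc k) (alongR e)  = Maybe.map inj₁ (chainColour k e)
treeColour (suc k) exitR       = nothing
treeColour (suc k) (withinR e) = Maybe.map inj₂ (treeColour k e)

leaf : ∀ k → Leaf k → TreeVertex k
leaf zero    _        = root
leaf (suc k) (inj₁ c) = subL (leaf k c)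
leaf (suc k) (inj₂ c) = subR (leaf k c)

-- Contains every vertex reachable from the root once colour c fails, and no leaf other than leaf c.
Compatible : ∀ {k} → Leaf k → TreeVertex k → Set
Compatible         _        root       = ⊤
Compatible {zero}  _        (inj₂ ())
Compatible {suc k} (inj₁ c) (chainL _) = ⊤
Compatible {suc k} (inj₁ c) (subL x)   = Compatible c x
Compatible {suc k} (inj₁ c) (chainR x) = Before c x
Compatible {suc k} (inj₁ c) (subR _)   = ⊥
Compatible {suc k} (inj₂ c) (chainL x) = Before c x
Compatible {suc k} (inj₂ c) (subL _)   = ⊥
Compatible {suc k} (inj₂ c) (chainR _) = ⊤
Compatible {suc k} (inj₂ c) (subR x)   = Compatible c x

compatible-closed : ∀ k (c : Leaf k) e → treeColour k e ≢ just c
                  → Compatible c (treeSource k e) → Compatible c (treeTarget k e)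
compatible-closed (suc k) (inj₁ c) enterL      _  _ = tt
compatible-closed (suc k) (inj₁ c) (alongL e)  _  _ = tt
compatible-closed (suc k) (inj₁ c) exitL       _  _ = tt
compatible-closed (suc k) (inj₁ c) (withinL e) ≢c   = compatible-closed k c e (≢c ∘ cong (Maybe.map inj₁))
compatible-closed (suc k) (inj₁ c) enterR      _  _ = before-first k c
compatible-closed (suc k) (inj₁ c) (alongR e)  ≢c   = before-closed k c e (≢c ∘ cong (Maybe.map inj₁))
compatible-closed (suc k) (inj₁ c) exitR       _    = ¬before-last k c
compatible-closed (suc k) (inj₁ c) (withinR e) _    ()
compatible-closed (suc k) (inj₂ c) enterL      _  _ = before-first k c
compatible-closed (suc k) (inj₂ c) (alongL e)  ≢c   = before-closed k c e (≢c ∘ cong (Maybe.map inj₂))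
compatible-closed (suc k) (inj₂ c) exitL       _    = ¬before-last k c
compatible-closed (suc k) (inj₂ c) (withinL e) _    ()
compatible-closed (suc k) (inj₂ c) enterR      _  _ = tt
compatible-closed (suc k) (inj₂ c) (alongR e)  _  _ = tt
compatible-closed (suc k) (inj₂ c) exitR       _  _ = tt
compatible-closed (suc k) (inj₂ c) (withinR e) ≢c   = compatible-closed k c e (≢c ∘ cong (Maybe.map inj₂))

leaf-compatible : ∀ k (c : Leaf k) → Compatible c (leaf k c)
leaf-compatible zero    _        = tt
leaf-compatible (suc k) (inj₁ c) = leaf-compatible k c
leaf-compatible (suc k) (inj₂ c) = leaf-compatible k c

compatible-leaf⇒≡ : ∀ k {c c′ : Leaf k} → Compatible c (leaf k c′) → c′ ≡ c
compatible-leaf⇒≡ zero    {tt}     {tt}      _ = refl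
compatible-leaf⇒≡ (suc k) {inj₁ c} {inj₁ c′} p = cong inj₁ (compatible-leaf⇒≡ k p)
compatible-leaf⇒≡ (suc k) {inj₂ c} {inj₂ c′} p = cong inj₂ (compatible-leaf⇒≡ k p)

leaf-injective : ∀ k {c c′ : Leaf k} → leaf k c ≡ leaf k c′ → c ≡ c′
leaf-injective k {c′ = c′} eq = compatible-leaf⇒≡ k (subst (Compatible c′) (sym eq) (leaf-compatible k c′))

root⇝leaf : ∀ k (c : Leaf k) → Walk (tree k) (λ e → treeColour k e ≢ just c) root (leaf k c)
root⇝leaf zero    _        = []
root⇝leaf (suc k) (inj₁ c) =
  step enterL (λ ())
    (walk-map (hom chainL alongL (λ _ → refl) (λ _ → refl))
              (λ e _ → map-inj₂≢just-inj₁ (chainColour k e)) (chain-traversal k)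
     ++ step exitL (λ ())
          (walk-map (hom subL withinL (λ _ → refl) (λ _ → refl))
                    (λ _ ≢c → ≢c ∘ map-injective inj₁-injective) (root⇝leaf k c)))
root⇝leaf (suc k) (inj₂ c) =
  step enterR (λ ())
    (walk-map (hom chainR alongR (λ _ → refl) (λ _ → refl))
              (λ e _ → map-inj₁≢just-inj₂ (chainColour k e)) (chain-traversal k)
     ++ step exitR (λ ())
          (walk-map (hom subR withinR (λ _ → refl) (λ _ → refl))
                    (λ _ ≢c → ≢c ∘ map-injective inj₂-injective) (root⇝leaf k c)))

tree-loopless : ∀ k e → treeSource k e ≢ treeTarget k e
tree-loopless (suc k) enterL      ()
tree-loopless (suc k) (alongL e)  = chain-loopless k e ∘ inj₁-injective ∘ inj₁-injective ∘ inj₂-injective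
tree-loopless (suc k) exitL       ()
tree-loopless (suc k) (withinL e) = tree-loopless k e ∘ inj₂-injective ∘ inj₁-injective ∘ inj₂-injective
tree-loopless (suc k) enterR      ()
tree-loopless (suc k) (alongR e)  = chain-loopless k e ∘ inj₁-injective ∘ inj₂-injective ∘ inj₂-injective
tree-loopless (suc k) exitR       ()
tree-loopless (suc k) (withinR e) = tree-loopless k e ∘ inj₂-injective ∘ inj₂-injective ∘ inj₂-injective

treeInEdge : ∀ k → TreeVertex k → Maybe (TreeEdge k)
treeInEdge _       root       = nothing
treeInEdge (suc k) (chainL x) = maybe (λ e → just (alongL e)) (just enterL) (chainInEdge k x)
treeInEdge (suc k) (subL x)   = maybe (λ e → just (withinL e)) (just exitL) (treeInEdge k x)
treeInEdge (suc k) (chainR x) = maybe (λ e → just (alongR e)) (just enterR) (chainInEdge k x)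
treeInEdge (suc k) (subR x)   = maybe (λ e → just (withinR e)) (just exitR) (treeInEdge k x)

treeInEdge-target : ∀ k e → treeInEdge k (treeTarget k e) ≡ just e
treeInEdge-target (suc k) enterL      rewrite chainInEdge-first k    = refl
treeInEdge-target (suc k) (alongL e)  rewrite chainInEdge-target k e = refl
treeInEdge-target (suc k) exitL       = refl
treeInEdge-target (suc k) (withinL e) rewrite treeInEdge-target k e  = refl
treeInEdge-target (suc k) enterR      rewrite chainInEdge-first k    = refl
treeInEdge-target (suc k) (alongR e)  rewrite chainInEdge-target k e = refl
treeInEdge-target (suc k) exitR       = refl
treeInEdge-target (suc k) (withinR e) rewrite treeInEdge-target k e  = refl

treeTarget-injective : ∀ k {e e′} → treeTarget k e ≡ treeTarget k e′ → e ≡ e′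
treeTarget-injective k = inEdge⇒target-injective (tree k) (treeInEdge k) (treeInEdge-target k)

treeTarget≢root : ∀ k e → treeTarget k e ≢ root
treeTarget≢root k = inEdge-nothing⇒target≢ (tree k) (treeInEdge k) (treeInEdge-target k) refl

leaves : ℕ → ℕ
leaves zero    = 1
leaves (suc k) = leaves k + leaves k

chainVertices : ℕ → ℕ
chainVertices zero    = 1 + 1
chainVertices (suc k) = chainVertices k + chainVertices k

chainEdges : ℕ → ℕ
chainEdges zero    = 1
chainEdges (suc k) = chainEdges k + (1 + chainEdges k)

belowRoot : ℕ → ℕ
belowRoot zero    = 0
belowRoot (suc k) = (chainVertices k + (1 + belowRoot k)) + (chainVertices k + (1 + belowRoot k))

treeVertices : ℕ → ℕ
treeVertices k = 1 + belowRoot k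

treeEdges : ℕ → ℕ
treeEdges zero    = 0
treeEdges (suc k) = (1 + (chainEdges k + (1 + treeEdges k))) + (1 + (chainEdges k + (1 + treeEdges k)))

leafEnum : ∀ k → Leaf k ↔ Fin (leaves k)
leafEnum zero    = ⊤ᶠ
leafEnum (suc k) = leafEnum k ⊎ᶠ leafEnum k

chainVertexEnum : ∀ k → ChainVertex k ↔ Fin (chainVertices k)
chainVertexEnum zero    = ⊤ᶠ ⊎ᶠ ⊤ᶠ
chainVertexEnum (suc k) = chainVertexEnum k ⊎ᶠ chainVertexEnum k

chainEdgeEnum : ∀ k → ChainEdge k ↔ Fin (chainEdges k)
chainEdgeEnum zero    = ⊤ᶠ
chainEdgeEnum (suc k) = chainEdgeEnum k ⊎ᶠ (⊤ᶠ ⊎ᶠ chainEdgeEnum k)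

belowRootEnum : ∀ k → BelowRoot k ↔ Fin (belowRoot k)
belowRootEnum zero    = ⊥ᶠ
belowRootEnum (suc k) = branch ⊎ᶠ branch
  where
    branch : (ChainVertex k ⊎ TreeVertex k) ↔ Fin (chainVertices k + treeVertices k)
    branch = chainVertexEnum k ⊎ᶠ (⊤ᶠ ⊎ᶠ belowRootEnum k)

treeVertexEnum : ∀ k → TreeVertex k ↔ Fin (treeVertices k)
treeVertexEnum k = ⊤ᶠ ⊎ᶠ belowRootEnum k

treeEdgeEnum : ∀ k → TreeEdge k ↔ Fin (treeEdges k)
treeEdgeEnum zero    = ⊥ᶠ
treeEdgeEnum (suc k) = branch ⊎ᶠ branch
  where
    branch : (⊤ ⊎ (ChainEdge k ⊎ (⊤ ⊎ TreeEdge k))) ↔ Fin (1 + (chainEdges k + (1 + treeEdges k)))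
    branch = ⊤ᶠ ⊎ᶠ (chainEdgeEnum k ⊎ᶠ (⊤ᶠ ⊎ᶠ treeEdgeEnum k))

-- The lower-bound graph

HubVertex : ℕ → ℕ → Set
HubVertex k B = Fin B ⊎ TreeVertex k

HubEdge : ℕ → ℕ → Set
HubEdge k B = (Leaf k × Fin B) ⊎ (Fin B ⊎ TreeEdge k)

pattern hub j      = inj₁ j
pattern inTree x   = inj₂ x
pattern toHub c j  = inj₁ (c , j)
pattern fromHub j  = inj₂ (inj₁ j)
pattern treeEdge e = inj₂ (inj₂ e)

hubSource : ∀ k B → HubEdge k B → HubVertex k B
hubSource k B (toHub c j)  = inTree (leaf k c)
hubSource k B (fromHub j)  = hub j
hubSource k B (treeEdge e) = inTree (treeSource k e)

hubTarget : ∀ k B → HubEdge k B → HubVertex k B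
hubTarget k B (toHub c j)  = hub j
hubTarget k B (fromHub j)  = inTree root
hubTarget k B (treeEdge e) = inTree (treeTarget k e)

hubColour : ∀ k B → HubEdge k B → Maybe (Leaf k)
hubColour k B (treeEdge e) = treeColour k e
hubColour k B _            = nothing

treeWithHubs : ℕ → ℕ → Graph
treeWithHubs k B = record
  { Vertex = HubVertex k B ; Edge = HubEdge k B ; source = hubSource k B ; target = hubTarget k B }

hubVertexEnum : ∀ k B → HubVertex k B ↔ Fin (B + treeVertices k)
hubVertexEnum k B = ↔-refl ⊎ᶠ treeVertexEnum k

hubEdgeEnum : ∀ k B → HubEdge k B ↔ Fin (leaves k * B + (B + treeEdges k))
hubEdgeEnum k B = (leafEnum k ×ᶠ ↔-refl) ⊎ᶠ (↔-refl ⊎ᶠ treeEdgeEnum k)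

colourCode : ∀ {k} → Maybe (Leaf k) → ℕ
colourCode     nothing  = 0
colourCode {k} (just c) = suc (toℕ (Inverse.to (leafEnum k) c))

colourCode-injective : ∀ {k} (m : Maybe (Leaf k)) {c} → colourCode m ≡ colourCode (just c) → m ≡ just c
colourCode-injective nothing      ()
colourCode-injective {k} (just c′) eq =
  cong just (Injection.injective (↔⇒↣ (leafEnum k)) (toℕ-injective (suc-injective eq)))

treeWithHubs-loopless : ∀ k B e → hubSource k B e ≢ hubTarget k B e
treeWithHubs-loopless k B (toHub c j)  ()
treeWithHubs-loopless k B (fromHub j)  ()
treeWithHubs-loopless k B (treeEdge e) = tree-loopless k e ∘ inj₂-injective

treeWithHubs-no-parallel : ∀ k B e e′ → hubSource k B e ≡ hubSource k B e′ → hubTarget k B e ≡ hubTarget k B e′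
                         → e ≡ e′
treeWithHubs-no-parallel k B (toHub c j)  (toHub c′ j′) s t =
  cong₂ (λ c j → toHub c j) (leaf-injective k (inj₂-injective s)) (inj₁-injective t)
treeWithHubs-no-parallel k B (toHub _ _)  (fromHub _)   _ ()
treeWithHubs-no-parallel k B (toHub _ _)  (treeEdge _)  _ ()
treeWithHubs-no-parallel k B (fromHub _)  (toHub _ _)   _ ()
treeWithHubs-no-parallel k B (fromHub j)  (fromHub j′)  s _ = cong fromHub (inj₁-injective s)
treeWithHubs-no-parallel k B (fromHub _)  (treeEdge e′) _ t =
  ⊥-elim (treeTarget≢root k e′ (sym (inj₂-injective t)))
treeWithHubs-no-parallel k B (treeEdge _) (toHub _ _)   _ ()
treeWithHubs-no-parallel k B (treeEdge e) (fromHub _)   _ t =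
  ⊥-elim (treeTarget≢root k e (inj₂-injective t))
treeWithHubs-no-parallel k B (treeEdge e) (treeEdge e′) _ t =
  cong treeEdge (treeTarget-injective k (inj₂-injective t))

module LowerBound (k B : ℕ) where

  open Encoding (treeWithHubs k B) (hubVertexEnum k B) (hubEdgeEnum k B) (colourCode ∘ hubColour k B) public

  simple : Simple digraph
  simple = digraph-simple (treeWithHubs-loopless k B) (treeWithHubs-no-parallel k B)

  fault : Leaf k → Maybe ℕ
  fault c = just (colourCode (just c))

  avoiding⇒allowedG : ∀ {c} e → hubColour k B e ≢ just c → AllowedG digraph (fault c) (encodeEdge e)
  avoiding⇒allowedG e ≢c eq = ≢c (colourCode-injective (hubColour k B e) (trans (sym (col-encodeEdge e)) eq))

  allowedH⇒avoiding : ∀ {H c} e → AllowedH digraph H (fault c) (encodeEdge e) → hubColour k B e ≢ just c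
  allowedH⇒avoiding e (_ , ¬failed) eq = ¬failed (trans (col-encodeEdge e) (cong colourCode eq))

  leaf⇄hub : ∀ c j → StronglyConnected digraph (AllowedG digraph (fault c))
                                         (encodeVertex (inTree (leaf k c))) (encodeVertex (hub j))
  leaf⇄hub c j =
      walk→reach (step (toHub c j) (avoiding⇒allowedG (toHub c j) (λ ())) [])
    , walk→reach (step (fromHub j) (avoiding⇒allowedG (fromHub j) (λ ()))
                   (walk-map (hom inTree treeEdge (λ _ → refl) (λ _ → refl))
                             (λ e → avoiding⇒allowedG (treeEdge e)) (root⇝leaf k c)))

  -- Invariant of the paths from leaf c in H − c: a hub is only ever entered from leaf c.
  Confined : Subset (nE digraph) → Leaf k → HubVertex k B → Set
  Confined H c (hub j)    = encodeEdge (toHub c j) ∈ H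
  Confined H c (inTree x) = Compatible c x

  confined-closed : ∀ H c e → AllowedH digraph H (fault c) (encodeEdge e)
                 → Confined H c (hubSource k B e) → Confined H c (hubTarget k B e)
  confined-closed H c (toHub c′ j)  (e∈H , _) p =
    subst (λ c″ → encodeEdge (toHub c″ j) ∈ H) (compatible-leaf⇒≡ k p) e∈H
  confined-closed H c (fromHub j)   _         _ = tt
  confined-closed H c (treeEdge e)  allowed   p = compatible-closed k c e (allowedH⇒avoiding (treeEdge e) allowed) p

  preserver-keeps-leaf-hub-edges : ∀ H → OneCFTPreserver digraph H → ∀ c j → encodeEdge (toHub c j) ∈ H
  preserver-keeps-leaf-hub-edges H preserves c j =
    preserved-along (Confined H c) (confined-closed H c) leaf⇝hub (leaf-compatible k c)
    where
      leaf⇝hub : Walk (treeWithHubs k B) (AllowedH digraph H (fault c) ∘ encodeEdge) (inTree (leaf k c)) (hub j)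
      leaf⇝hub = reach→walk-encoded (proj₁ (proj₁ (preserves (fault c) _ _) (leaf⇄hub c j)))

  -- encodeEdge (toHub c j) computes to (the index of (c , j)) ↑ˡ _: leaf-hub edges form a prefix.
  preserver-size : ∀ H → OneCFTPreserver digraph H → leaves k * B ≤ ∣ H ∣
  preserver-size H preserves = prefix⊆p⇒m≤∣p∣ (leaves k * B) H λ i →
    subst (λ i′ → i′ ↑ˡ (B + treeEdges k) ∈ H) (Inverse.strictlyInverseˡ (leafEnum k ×ᶠ ↔-refl) i)
      (preserver-keeps-leaf-hub-edges H preserves _ _)

-- Arithmetic

leaves≡2^ : ∀ k → leaves k ≡ 2 ^ k
leaves≡2^ zero    = refl
leaves≡2^ (suc k) = trans (cong (λ l → l + l) (leaves≡2^ k)) (cong (2 ^ k +_) (sym (+-identityʳ (2 ^ k))))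

chainVertices≡2*leaves : ∀ k → chainVertices k ≡ 2 * leaves k
chainVertices≡2*leaves zero    = refl
chainVertices≡2*leaves (suc k) =
  trans (cong₂ _+_ (chainVertices≡2*leaves k) (chainVertices≡2*leaves k))
        (sym (*-distribˡ-+ 2 (leaves k) (leaves k)))

treeVertices<2[1+k]leaves : ∀ k → treeVertices k < 2 * (suc k * leaves k)
treeVertices<2[1+k]leaves zero    = ≤-refl
treeVertices<2[1+k]leaves (suc k) = begin
  suc (1 + ((c + t) + (c + t)))              ≡⟨ regroup c t ⟩
  (c + c) + (suc t + suc t)                  ≤⟨ +-monoʳ-≤ (c + c) (+-mono-≤ ih ih) ⟩
  (c + c) + (b + b)                          ≡⟨ cong (λ x → (x + x) + (b + b)) (chainVertices≡2*leaves k) ⟩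
  (2 * l + 2 * l) + (b + b)                  ≡⟨ collect k l ⟩
  2 * (suc (suc k) * (l + l))                ∎
  where
    open ≤-Reasoning
    c t l b : ℕ
    c = chainVertices k
    t = treeVertices k
    l = leaves k
    b = 2 * (suc k * l)
    ih : suc t ≤ b
    ih = treeVertices<2[1+k]leaves k
    regroup : ∀ c t → suc (1 + ((c + t) + (c + t))) ≡ (c + c) + (suc t + suc t)
    regroup = solve-∀
    collect : ∀ k l → (2 * l + 2 * l) + (2 * (suc k * l) + 2 * (suc k * l)) ≡ 2 * (suc (suc k) * (l + l))
    collect = solve-∀

2*⌊n/2⌋≤n : ∀ n → 2 * ⌊ n /2⌋ ≤ n
2*⌊n/2⌋≤n n = begin
  2 * ⌊ n /2⌋         ≡⟨ cong (⌊ n /2⌋ +_) (+-identityʳ ⌊ n /2⌋) ⟩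
  ⌊ n /2⌋ + ⌊ n /2⌋   ≤⟨ +-monoʳ-≤ ⌊ n /2⌋ (⌊n/2⌋≤⌈n/2⌉ n) ⟩
  ⌊ n /2⌋ + ⌈ n /2⌉   ≡⟨ ⌊n/2⌋+⌈n/2⌉≡n n ⟩
  n                   ∎
  where open ≤-Reasoning

2^⌊log2⌋≤ : ∀ n (rec : Acc _<_ n) → 1 ≤ n → 2 ^ ⌊log2⌋ n rec ≤ n
2^⌊log2⌋≤ (suc zero)    _         _ = ≤-refl
2^⌊log2⌋≤ (suc (suc n)) (acc rec) _ =
  ≤-trans (*-monoʳ-≤ 2 (2^⌊log2⌋≤ (suc ⌊ n /2⌋) _ (s≤s z≤n))) (2*⌊n/2⌋≤n (suc (suc n)))

2^⌊log₂n⌋≤n : ∀ {n} → 1 ≤ n → 2 ^ ⌊log₂ n ⌋ ≤ n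
2^⌊log₂n⌋≤n {n} = 2^⌊log2⌋≤ n (<-wellFounded n)

n<2^[1+⌊log₂n⌋] : ∀ n → n < 2 ^ suc ⌊log₂ n ⌋
n<2^[1+⌊log₂n⌋] n = ≰⇒> λ 2^[1+⌊log₂n⌋]≤n →
  n≮n ⌊log₂ n ⌋ (subst (_≤ ⌊log₂ n ⌋) (⌊log₂[2^n]⌋≡n (suc ⌊log₂ n ⌋))
                       (⌊log₂⌋-mono-≤ 2^[1+⌊log₂n⌋]≤n))

n<2^n : ∀ n → n < 2 ^ n
n<2^n zero    = s≤s z≤n
n<2^n (suc n) = +-mono-≤ (m^n>0 2 n) (≤-trans (n<2^n n) (m≤m+n (2 ^ n) 0))

-- 2^k ≈ n / log n, so that the tree has about k 2^k ≈ n vertices.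
module Parameters (n : ℕ) (2≤n : 2 ≤ n) where

  L ℓ k : ℕ
  L = ⌊log₂ n ⌋
  ℓ = ⌊log₂ L ⌋
  k = L ∸ ℓ

  1≤L : 1 ≤ L
  1≤L = subst (_≤ L) (⌊log₂[2^n]⌋≡n 1) (⌊log₂⌋-mono-≤ 2≤n)

  2^k*2^ℓ≡2^L : 2 ^ k * 2 ^ ℓ ≡ 2 ^ L
  2^k*2^ℓ≡2^L = trans (sym (^-distribˡ-+-* 2 k ℓ)) (cong (2 ^_) (m∸n+n≡m ℓ≤L))
    where
      ℓ≤L : ℓ ≤ L
      ℓ≤L = ≤-trans (<⇒≤ (n<2^n ℓ)) (2^⌊log₂n⌋≤n 1≤L)

  n≤2*2^k*L : n ≤ 2 * (2 ^ k * L)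
  n≤2*2^k*L = begin
    n                     ≤⟨ <⇒≤ (n<2^[1+⌊log₂n⌋] n) ⟩
    2 * 2 ^ L             ≡⟨ cong (2 *_) 2^k*2^ℓ≡2^L ⟨
    2 * (2 ^ k * 2 ^ ℓ)   ≤⟨ *-monoʳ-≤ 2 (*-monoʳ-≤ (2 ^ k) (2^⌊log₂n⌋≤n 1≤L)) ⟩
    2 * (2 ^ k * L)       ∎
    where open ≤-Reasoning

  [1+k]*2^k≤2n : suc k * 2 ^ k ≤ 2 * n
  [1+k]*2^k≤2n = begin
    suc k * 2 ^ k         ≤⟨ *-monoˡ-≤ (2 ^ k) (s≤s (m∸n≤m L ℓ)) ⟩
    suc L * 2 ^ k         ≤⟨ *-monoˡ-≤ (2 ^ k) (n<2^[1+⌊log₂n⌋] L) ⟩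
    (2 * 2 ^ ℓ) * 2 ^ k   ≡⟨ regroup (2 ^ k) (2 ^ ℓ) ⟩
    2 * (2 ^ k * 2 ^ ℓ)   ≡⟨ cong (2 *_) 2^k*2^ℓ≡2^L ⟩
    2 * 2 ^ L             ≤⟨ *-monoʳ-≤ 2 (2^⌊log₂n⌋≤n (≤-trans (s≤s z≤n) 2≤n)) ⟩
    2 * n                 ∎
    where
      open ≤-Reasoning
      regroup : ∀ a b → (2 * b) * a ≡ 2 * (a * b)
      regroup = solve-∀

  vertices≤5n : n + treeVertices k ≤ 5 * n
  vertices≤5n = begin
    n + treeVertices k              ≤⟨ +-monoʳ-≤ n (<⇒≤ (treeVertices<2[1+k]leaves k)) ⟩
    n + 2 * (suc k * leaves k)      ≡⟨ cong (λ l → n + 2 * (suc k * l)) (leaves≡2^ k) ⟩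
    n + 2 * (suc k * 2 ^ k)         ≤⟨ +-monoʳ-≤ n (*-monoʳ-≤ 2 [1+k]*2^k≤2n) ⟩
    n + 2 * (2 * n)                 ≡⟨ collect n ⟩
    5 * n                           ∎
    where
      open ≤-Reasoning
      collect : ∀ n → n + 2 * (2 * n) ≡ 5 * n
      collect = solve-∀

  n²≤2*h*L : ∀ h → leaves k * n ≤ h → n ^ 2 ≤ 2 * (h * L)
  n²≤2*h*L h leaves*n≤h = begin
    n ^ 2                      ≡⟨ cong (n *_) (*-identityʳ n) ⟩
    n * n                      ≤⟨ *-monoˡ-≤ n n≤2*2^k*L ⟩
    2 * (2 ^ k * L) * n        ≡⟨ regroup (2 ^ k) L n ⟩
    2 * ((2 ^ k * n) * L)      ≡⟨ cong (λ l → 2 * ((l * n) * L)) (leaves≡2^ k) ⟨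
    2 * ((leaves k * n) * L)   ≤⟨ *-monoʳ-≤ 2 (*-monoˡ-≤ L leaves*n≤h) ⟩
    2 * (h * L)                ∎
    where
      open ≤-Reasoning
      regroup : ∀ a b c → 2 * (a * b) * c ≡ 2 * ((a * c) * b)
      regroup = solve-∀

theoremB5 : ∃[ a ] ∃[ b ] ∃[ c ] ∃[ N₀ ] ∀ (n : ℕ) → N₀ ≤ n →
                ∃[ G ] (Simple G
                        × n ≤ a * nV G × nV G ≤ b * n
                        × (∀ (H : Subset (nE G)) → OneCFTPreserver G H →
                             n ^ 2 ≤ c * (∣ H ∣ * ⌊log₂ n ⌋)))
theoremB5 = 1 , 5 , 2 , 2 , λ n 2≤n →
  let open Parameters n 2≤n
      open LowerBound k n
  in  digraph , simple
    , ≤-trans (m≤m+n n (treeVertices k)) (≤-reflexive (sym (*-identityˡ _)))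
    , vertices≤5n
    , λ H preserves → n²≤2*h*L ∣ H ∣ (preserver-size H preserves)
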